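{- Let $n\ge2$ and $1\le k<n$. If $\underline{a}=a_1\cdots a_k1\cdots1$ (with $a_j=1$ for all $k<j\le n$) is a word of $G_n$ and the next word in $G_n$ is $a_1\cdots a_{k-1}a'_k1\cdots1$, then $a'_k=a_k+1$ implies that $a_k$ is even, and $a'_k=a_k-1$ implies that $a_k$ is odd. Similarly, if $\underline{a}=a_1\cdots a_k(2k+1)\cdots(2n-1)$ (with $a_j=2j-1$ for all $k<j\le n$) and the next word in $G_n$ is $a_1\cdots a_{k-1}a'_k(2k+1)\cdots(2n-1)$, then $a'_k=a_k+1$ implies that $a_k$ is odd, and $a'_k=a_k-1$ implies that $a_k$ is even.
   Context: The list $G_n$ of words $a_1\cdots a_n$ (with $1\le a_i\le 2i-1$) is defined recursively: $G_1=(1)$; for $n\ge2$, if $G_{n-1}=(w_1,\ldots,w_N)$, then $G_n$ is the concatenation over $m=1,\ldots,N$ of the blocks $(w_m1,w_m2,\ldots,w_m(2n-1))$ for $m$ odd and $(w_m(2n-1),\ldots,w_m1)$ for $m$ even, where $w_mx$ denotes $w_m$ with the letter $x$ appended. -}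

module Defs where

open import Data.Nat using (ℕ; zero; suc; _+_; _*_; _∸_)
open import Data.List using (List; []; _∷_; _++_; [_]; map; concat; reverse; upTo; replicate)
open import Data.Bool using (Bool; true; false; not)
open import Data.Product using (∃; ∃-syntax; _×_; _,_)
open import Relation.Binary.PropositionalEquality using (_≡_)

Word : Set
Word = List ℕ

oneTo : ℕ → List ℕ
oneTo m = map suc (upTo m)

-- block for w_m with new letters 1..(2n-1); `odd` says whether m is odd
-- (ascending) or even (descending).
block : Bool → ℕ → Word → List Word
block true  top w = map (λ x → w ++ [ x ]) (oneTo top)
block false top w = reverse (map (λ x → w ++ [ x ]) (oneTo top))

-- concatenate blocks over w₁,…,w_N; the Bool is "current index m is odd"
blocks : Bool → ℕ → List Word → List Word
blocks b top []       = []
blocks b top (w ∷ ws) = block b top w ++ blocks (not b) top ws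

-- G n, for n ≥ 1 (G 0 is the empty list and is never used).
G : ℕ → List Word
G zero          = []
G (suc zero)    = [ 1 ∷ [] ]
G (suc (suc n)) = blocks true (2 * suc (suc n) ∸ 1) (G (suc n))

NextIn : List Word → Word → Word → Set
NextIn L u v = ∃[ pre ] ∃[ suf ] (L ≡ pre ++ (u ∷ v ∷ suf))

oddTail : ℕ → ℕ → List ℕ
oddTail k n = map (λ i → 2 * (k + suc i) ∸ 1) (upTo (n ∸ k))

module Submission where

-- Number the words of G L by their rank 1, 2, 3, … .  The list
-- G (L+1) is made of blocks w·1, …, w·t (t = 2L+1), one per word w of G L,
-- ascending when the rank of w is odd and descending when it is even.  Hence
-- two consecutive words of G (L+1) are either
--   (i)  w·x, w·x' inside one block, with {x, x'} = {y, y+1}, and then y has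
--        the parity of the rank of w·x (blocks have odd length), or
--   (ii) w·c, w'·c across two blocks, where w, w' are consecutive in G L and
--        c = t if the rank of w is odd, c = 1 if it is even.
-- We record the rank parity of every consecutive pair in an alternating chain
-- and prove by induction on L the invariant StepInv: for a pair (u, v) of rank
-- parity p, a change of the last letter is a step y ↔ y+1 with parity y = p,
-- and a change at position k < L followed by the suffix 1⋯1 (resp.
-- (2k+1)⋯(2L-1)) is a step y ↔ y+1 with y even (resp. odd).  Type (i) pairs
-- satisfy this directly; for type (ii) pairs, a change in front of the new
-- letter c = 1 (resp. c = t) comes from a last-letter step of an even (resp.
-- odd) rank pair of G L.  The corollary reads off the suffix clauses.

open import Defs
open import Data.Nat using (ℕ; zero; suc; _+_; _*_; _∸_; _≤_; _<_; s≤s; parity)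
open import Data.Nat.Properties
  using (+-suc; +-identityʳ; +-∸-assoc; m+[n∸m]≡n; n∸n≡0; m≤n⇒m<n∨m≡n; 1+n≢n; m≢1+n+m)
open import Data.Nat.Divisibility using (_∣_; divides)
open import Data.Parity.Base using (Parity; 0ℙ; 1ℙ; _⁻¹)
open import Data.Parity.Properties using (suc-homo-⁻¹; ⁻¹-selfInverse; +-homo-+; *-homo-*; p+p≡0ℙ; *-zeroʳ)
open import Data.List
  using (List; []; _∷_; _++_; [_]; _∷ʳ_; length; replicate; map; reverse; applyUpTo; applyDownFrom; upTo)
open import Data.List.Properties
  using (∷ʳ-injective; ∷ʳ-injectiveʳ; ++-assoc; map-∘; map-upTo; applyUpTo-∷ʳ; reverse-++)
open import Data.Bool using (Bool; true; false)
open import Data.Product using (_×_; _,_; ∃)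
open import Data.Sum using (inj₁; inj₂)
open import Data.Unit using (⊤; tt)
open import Data.Empty using (⊥-elim)
open import Relation.Nullary using (¬_)
open import Relation.Binary.PropositionalEquality
  using (_≡_; _≢_; refl; sym; trans; cong; cong₂; subst; module ≡-Reasoning)

parity-suc : ∀ n → parity (suc n) ≡ parity n ⁻¹
parity-suc n = sym (⁻¹-selfInverse (suc-homo-⁻¹ n))

parity-double : ∀ n → parity (n + n) ≡ 0ℙ
parity-double n = trans (+-homo-+ n n) (p+p≡0ℙ (parity n))

parity≡0ℙ⇒2∣ : ∀ n → parity n ≡ 0ℙ → 2 ∣ n
parity≡0ℙ⇒2∣ zero          _    = divides 0 refl
parity≡0ℙ⇒2∣ (suc (suc n)) even with parity≡0ℙ⇒2∣ n even
... | divides q n≡2q = divides (suc q) (cong (λ m → suc (suc m)) n≡2q)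

parity≡1ℙ⇒2∤ : ∀ n → parity n ≡ 1ℙ → ¬ (2 ∣ n)
parity≡1ℙ⇒2∤ n odd (divides q refl) with trans (sym odd) (trans (*-homo-* q 2) (*-zeroʳ (parity q)))
... | ()

StepFrom : Parity → ℕ → ℕ → Set
StepFrom p a a' = (a' ≡ suc a → parity a ≡ p) × (suc a' ≡ a → parity a' ≡ p)

even-step : ∀ {a a'} → StepFrom 0ℙ a a' → (a' ≡ suc a → 2 ∣ a) × (suc a' ≡ a → ¬ (2 ∣ a))
even-step {a} {a'} (up , down) =
  (λ a'≡1+a → parity≡0ℙ⇒2∣ a (up a'≡1+a)) ,
  (λ { refl → parity≡1ℙ⇒2∤ (suc a') (trans (parity-suc a') (cong _⁻¹ (down refl))) })

odd-step : ∀ {a a'} → StepFrom 1ℙ a a' → (a' ≡ suc a → ¬ (2 ∣ a)) × (suc a' ≡ a → 2 ∣ a)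
odd-step {a} {a'} (up , down) =
  (λ a'≡1+a → parity≡1ℙ⇒2∤ a (up a'≡1+a)) ,
  (λ { refl → parity≡0ℙ⇒2∣ (suc a') (trans (parity-suc a') (cong _⁻¹ (down refl))) })

-- Every consecutive pair of the list satisfies R, the parity index starting
-- at p and flipping from one pair to the next (it is the parity of the rank
-- of the pair when p = 1ℙ).
Chain : {A : Set} → (Parity → A → A → Set) → Parity → List A → Set
Chain R p []           = ⊤
Chain R p (x ∷ [])     = ⊤
Chain R p (x ∷ y ∷ zs) = R p x y × Chain R (p ⁻¹) (y ∷ zs)

module _ {A : Set} {R : Parity → A → A → Set} where

  chain-adjacent : ∀ {p u v suf} pre → Chain R p (pre ++ u ∷ v ∷ suf) → ∃ λ q → R q u v
  chain-adjacent []            (r , _) = _ , r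
  chain-adjacent (x ∷ [])      (_ , c) = chain-adjacent [] c
  chain-adjacent (x ∷ y ∷ pre) (_ , c) = chain-adjacent (y ∷ pre) c

  chain-enter : ∀ {p x y xs xs' ys} → xs ≡ y ∷ xs' → R p x y →
    Chain R (p ⁻¹) (xs ++ ys) → Chain R p (x ∷ xs ++ ys)
  chain-enter refl r c = r , c

  chain-cast : ∀ {p q xs} → p ≡ q → Chain R p xs → Chain R q xs
  chain-cast refl c = c

  chain-applyUpTo : (φ : ℕ → Parity) (g : ℕ → A) → (∀ i → φ (suc i) ≡ φ i ⁻¹) →
    (∀ i → R (φ i) (g i) (g (suc i))) →
    ∀ m {ys} → Chain R (φ m) (g m ∷ ys) → Chain R (φ 0) (applyUpTo g (suc m) ++ ys)
  chain-applyUpTo φ g flip step zero    c = c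
  chain-applyUpTo φ g flip step (suc m) c =
    step 0 , chain-cast (flip 0)
      (chain-applyUpTo (λ i → φ (suc i)) (λ i → g (suc i)) (λ i → flip (suc i)) (λ i → step (suc i)) m c)

  chain-applyDownFrom : (φ : ℕ → Parity) (g : ℕ → A) → (∀ i → φ (suc i) ≡ φ i ⁻¹) →
    (∀ i → R (φ (suc i)) (g (suc i)) (g i)) →
    ∀ m {ys} → Chain R (φ 0) (g 0 ∷ ys) → Chain R (φ m) (applyDownFrom g (suc m) ++ ys)
  chain-applyDownFrom φ g flip step zero    c = c
  chain-applyDownFrom φ g flip step (suc m) c =
    step m , chain-cast (sym (⁻¹-selfInverse (sym (flip m)))) (chain-applyDownFrom φ g flip step m c)

-- The largest letter allowed at position L + 1.
top : ℕ → ℕ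
top L = suc (L + L)

-- The top letter is odd, so an ascending block ends with parity index 1ℙ.
parity-top : ∀ L → parity (top L) ≡ 1ℙ
parity-top L = trans (parity-suc (L + L)) (cong _⁻¹ (parity-double L))

two-mul-suc∸1 : ∀ L → 2 * suc L ∸ 1 ≡ top L
two-mul-suc∸1 L = trans (+-suc L (L + 0)) (cong (λ m → suc (L + m)) (+-identityʳ L))

reverse-applyUpTo : ∀ {A : Set} (f : ℕ → A) n → reverse (applyUpTo f n) ≡ applyDownFrom f n
reverse-applyUpTo f zero    = refl
reverse-applyUpTo f (suc n) = begin
  reverse (applyUpTo f (suc n))  ≡⟨ cong reverse (sym (applyUpTo-∷ʳ f n)) ⟩
  reverse (applyUpTo f n ∷ʳ f n) ≡⟨ reverse-++ (applyUpTo f n) [ f n ] ⟩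
  f n ∷ reverse (applyUpTo f n)  ≡⟨ cong (f n ∷_) (reverse-applyUpTo f n) ⟩
  f n ∷ applyDownFrom f n        ∎
  where open ≡-Reasoning

block-ascending : ∀ t w → block true t w ≡ applyUpTo (λ i → w ∷ʳ suc i) t
block-ascending t w = trans (sym (map-∘ (upTo t))) (map-upTo (λ i → w ∷ʳ suc i) t)

block-descending : ∀ t w → block false t w ≡ applyDownFrom (λ i → w ∷ʳ suc i) t
block-descending t w =
  trans (cong reverse (block-ascending t w)) (reverse-applyUpTo (λ i → w ∷ʳ suc i) t)

module _ {R : Parity → Word → Word → Set} (L : ℕ) (w : Word) where

  ascending-block-chain : (∀ x → R (parity x) (w ∷ʳ x) (w ∷ʳ suc x)) →
    ∀ {ys} → Chain R 1ℙ (w ∷ʳ top L ∷ ys) → Chain R 1ℙ (block true (top L) w ++ ys)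
  ascending-block-chain step {ys} c =
    subst (λ B → Chain R 1ℙ (B ++ ys)) (sym (block-ascending (top L) w))
      (chain-applyUpTo (λ i → parity (suc i)) (λ i → w ∷ʳ suc i) (λ i → parity-suc (suc i))
        (λ i → step (suc i)) (L + L) (chain-cast (sym (parity-top L)) c))

  descending-block-chain : (∀ x → R (parity x) (w ∷ʳ suc x) (w ∷ʳ x)) →
    ∀ {ys} → Chain R 0ℙ (w ∷ʳ 1 ∷ ys) → Chain R 0ℙ (block false (top L) w ++ ys)
  descending-block-chain step {ys} c =
    subst (λ B → Chain R 0ℙ (B ++ ys)) (sym (block-descending (top L) w))
      (chain-cast (parity-double L)
        (chain-applyDownFrom parity (λ i → w ∷ʳ suc i) parity-suc (λ i → step (suc i)) (L + L) c))

ones : ℕ → ℕ → List ℕ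
ones k L = replicate (L ∸ k) 1

replicate-∷ʳ : ∀ n (x : ℕ) → replicate (suc n) x ≡ replicate n x ∷ʳ x
replicate-∷ʳ zero    x = refl
replicate-∷ʳ (suc n) x = cong (x ∷_) (replicate-∷ʳ n x)

ones-∷ʳ : ∀ {k L} → k ≤ L → ones k (suc L) ≡ ones k L ∷ʳ 1
ones-∷ʳ {k} {L} k≤L = trans (cong (λ n → replicate n 1) (+-∸-assoc 1 k≤L)) (replicate-∷ʳ (L ∸ k) 1)

ones-empty : ∀ L → ones L L ≡ []
ones-empty L = cong (λ n → replicate n 1) (n∸n≡0 L)

oddTail-∷ʳ : ∀ {k L} → k ≤ L → oddTail k (suc L) ≡ oddTail k L ∷ʳ top L
oddTail-∷ʳ {k} {L} k≤L = begin
  map f (upTo (suc L ∸ k))            ≡⟨ cong (λ n → map f (upTo n)) (+-∸-assoc 1 k≤L) ⟩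
  map f (upTo (suc (L ∸ k)))          ≡⟨ map-upTo f (suc (L ∸ k)) ⟩
  applyUpTo f (suc (L ∸ k))           ≡⟨ sym (applyUpTo-∷ʳ f (L ∸ k)) ⟩
  applyUpTo f (L ∸ k) ∷ʳ f (L ∸ k)   ≡⟨ cong₂ _∷ʳ_ (sym (map-upTo f (L ∸ k))) last-letter ⟩
  oddTail k L ∷ʳ top L                ∎
  where
  open ≡-Reasoning
  f : ℕ → ℕ
  f i = 2 * (k + suc i) ∸ 1
  last-letter : f (L ∸ k) ≡ top L
  last-letter = trans (cong (λ m → 2 * m ∸ 1) (trans (+-suc k (L ∸ k)) (cong suc (m+[n∸m]≡n k≤L))))
                      (two-mul-suc∸1 L)

oddTail-empty : ∀ L → oddTail L L ≡ []
oddTail-empty L = cong (λ n → map (λ i → 2 * (L + suc i) ∸ 1) (upTo n)) (n∸n≡0 L)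

LastStep : Parity → Word → Word → Set
LastStep p u v = ∀ w a a' → u ≡ w ∷ʳ a → v ≡ w ∷ʳ a' → StepFrom p a a'

module SuffixFamily (τ : ℕ → ℕ → List ℕ) (ℓ : ℕ → ℕ)
  (τ-∷ʳ : ∀ {k L} → k ≤ L → τ k (suc L) ≡ τ k L ∷ʳ ℓ L)
  (τ-empty : ∀ L → τ L L ≡ []) where

  SuffixSteps : Parity → ℕ → Word → Word → Set
  SuffixSteps p L u v = ∀ k pre a a' → k < L →
    u ≡ pre ++ a ∷ τ k L → v ≡ pre ++ a' ∷ τ k L → StepFrom p a a'

  split-last : ∀ {k L} (pre : List ℕ) a → k ≤ L →
    pre ++ a ∷ τ k (suc L) ≡ (pre ++ a ∷ τ k L) ∷ʳ ℓ L
  split-last pre a k≤L =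
    trans (cong (λ s → pre ++ a ∷ s) (τ-∷ʳ k≤L)) (sym (++-assoc pre (a ∷ _) [ _ ]))

  -- Words with different last letters never share a suffix τ k (L+1).
  suffixSteps-within : ∀ {p L} w {x y} → x ≢ y → SuffixSteps p (suc L) (w ∷ʳ x) (w ∷ʳ y)
  suffixSteps-within w x≢y k pre a a' (s≤s k≤L) u≡ v≡ =
    ⊥-elim (x≢y (trans (∷ʳ-injectiveʳ w _ (trans u≡ (split-last pre a k≤L)))
                       (sym (∷ʳ-injectiveʳ w _ (trans v≡ (split-last pre a' k≤L))))))

  -- Appending a common letter c: a change at position k < L is inherited,
  -- and a change at position L is a last-letter step of (w, w'), which can
  -- only sit in front of the suffix τ L (L+1) = ℓ L when c = ℓ L.
  suffixSteps-across : ∀ {p q L w w'} c → (c ≡ ℓ L → q ≡ p) →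
    LastStep q w w' → SuffixSteps p L w w' → SuffixSteps p (suc L) (w ∷ʳ c) (w' ∷ʳ c)
  suffixSteps-across {w = w} {w'} c c≡ℓ⇒q≡p last inner k pre a a' (s≤s k≤L) u≡ v≡
    with ∷ʳ-injective w _ (trans u≡ (split-last pre a k≤L))
       | ∷ʳ-injective w' _ (trans v≡ (split-last pre a' k≤L))
       | m≤n⇒m<n∨m≡n k≤L
  ... | w≡ , _   | w'≡ , _ | inj₁ k<L = inner k pre a a' k<L w≡ w'≡
  ... | w≡ , c≡ℓ | w'≡ , _ | inj₂ refl =
    subst (λ r → StepFrom r a a') (c≡ℓ⇒q≡p c≡ℓ)
      (last pre a a' (trans w≡ (drop-empty a)) (trans w'≡ (drop-empty a')))
    where
    drop-empty : ∀ b → pre ++ b ∷ τ k k ≡ pre ∷ʳ b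
    drop-empty b = cong (λ s → pre ++ b ∷ s) (τ-empty k)

module Ones = SuffixFamily ones (λ _ → 1) ones-∷ʳ ones-empty
module Odds = SuffixFamily oddTail top oddTail-∷ʳ oddTail-empty

-- The invariant of a consecutive pair (u, v) of words of length L whose
-- rank parity is p.
StepInv : ℕ → Parity → Word → Word → Set
StepInv L p u v = LastStep p u v × Ones.SuffixSteps 0ℙ L u v × Odds.SuffixSteps 1ℙ L u v

-- Last-letter steps inside a block start at the smaller letter x; across
-- blocks the last letter does not change.
lastStep-up : ∀ w x → LastStep (parity x) (w ∷ʳ x) (w ∷ʳ suc x)
lastStep-up w x w' a a' u≡ v≡ with ∷ʳ-injectiveʳ w w' u≡ | ∷ʳ-injectiveʳ w w' v≡
... | refl | refl = (λ _ → refl) , (λ 2+x≡x → ⊥-elim (m≢1+n+m x (sym 2+x≡x)))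

lastStep-down : ∀ w x → LastStep (parity x) (w ∷ʳ suc x) (w ∷ʳ x)
lastStep-down w x w' a a' u≡ v≡ with ∷ʳ-injectiveʳ w w' u≡ | ∷ʳ-injectiveʳ w w' v≡
... | refl | refl = (λ x≡2+x → ⊥-elim (m≢1+n+m x x≡2+x)) , (λ _ → refl)

lastStep-across : ∀ {p} w w' c → LastStep p (w ∷ʳ c) (w' ∷ʳ c)
lastStep-across w w' c v a a' u≡ v≡ with ∷ʳ-injectiveʳ w v u≡ | ∷ʳ-injectiveʳ w' v v≡
... | refl | refl = (λ c≡1+c → ⊥-elim (1+n≢n (sym c≡1+c))) , (λ 1+c≡c → ⊥-elim (1+n≢n 1+c≡c))

stepInv-up : ∀ L w x → StepInv (suc L) (parity x) (w ∷ʳ x) (w ∷ʳ suc x)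
stepInv-up L w x =
  lastStep-up w x , Ones.suffixSteps-within w x≢1+x , Odds.suffixSteps-within w x≢1+x
  where
  x≢1+x : x ≢ suc x
  x≢1+x x≡1+x = 1+n≢n (sym x≡1+x)

stepInv-down : ∀ L w x → StepInv (suc L) (parity x) (w ∷ʳ suc x) (w ∷ʳ x)
stepInv-down L w x = lastStep-down w x , Ones.suffixSteps-within w 1+n≢n , Odds.suffixSteps-within w 1+n≢n

-- The common new letter of a pair of type (ii): the block of an odd rank
-- word ends at the top letter, that of an even rank word at 1.
crossLetter : ℕ → Parity → ℕ
crossLetter L 1ℙ = top L
crossLetter L 0ℙ = 1

-- For words of length at least 1 the top letter is not 1, so the cross
-- letter determines the rank parity.
crossLetter≡1 : ∀ L p → crossLetter (suc L) p ≡ 1 → p ≡ 0ℙ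
crossLetter≡1 L 0ℙ _  = refl
crossLetter≡1 L 1ℙ ()

crossLetter≡top : ∀ L p → crossLetter (suc L) p ≡ top (suc L) → p ≡ 1ℙ
crossLetter≡top L 0ℙ ()
crossLetter≡top L 1ℙ _  = refl

-- Pairs of type (ii), for words of length at least 1 (so that top L ≠ 1).
stepInv-across : ∀ L p {w w'} → StepInv (suc L) p w w' →
  StepInv (suc (suc L)) p (w ∷ʳ crossLetter (suc L) p) (w' ∷ʳ crossLetter (suc L) p)
stepInv-across L p {w} {w'} (last , onesSteps , oddSteps) =
  lastStep-across w w' c ,
  Ones.suffixSteps-across c (crossLetter≡1 L p) last onesSteps ,
  Odds.suffixSteps-across c (crossLetter≡top L p) last oddSteps
  where
  c : ℕ
  c = crossLetter (suc L) p

-- Blocks are ascending exactly for the words of odd rank.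
ascending : Parity → Bool
ascending 1ℙ = true
ascending 0ℙ = false

-- One level of the recursion preserves the invariant, with the same parity
-- index at the start (the first block begins at rank ≡ 1 mod 2).
blocks-chain : ∀ L p ws → Chain (StepInv (suc L)) p ws →
  Chain (StepInv (suc (suc L))) p (blocks (ascending p) (top (suc L)) ws)
blocks-chain L p  []           _ = tt
blocks-chain L 1ℙ (w ∷ [])     _ = ascending-block-chain (suc L) w (stepInv-up (suc L) w) tt
blocks-chain L 0ℙ (w ∷ [])     _ = descending-block-chain (suc L) w (stepInv-down (suc L) w) tt
blocks-chain L 1ℙ (w ∷ w' ∷ ws) (pair , rest) =
  ascending-block-chain (suc L) w (stepInv-up (suc L) w)
    (chain-enter (block-descending (top (suc L)) w') (stepInv-across L 1ℙ pair)
      (blocks-chain L 0ℙ (w' ∷ ws) rest))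
blocks-chain L 0ℙ (w ∷ w' ∷ ws) (pair , rest) =
  descending-block-chain (suc L) w (stepInv-down (suc L) w)
    (chain-enter (block-ascending (top (suc L)) w') (stepInv-across L 0ℙ pair)
      (blocks-chain L 1ℙ (w' ∷ ws) rest))

G-chain : ∀ n → Chain (StepInv n) 1ℙ (G n)
G-chain zero          = tt
G-chain (suc zero)    = tt
G-chain (suc (suc n)) =
  subst (λ t → Chain (StepInv (suc (suc n))) 1ℙ (blocks true t (G (suc n))))
    (sym (two-mul-suc∸1 (suc n))) (blocks-chain n 1ℙ (G (suc n)) (G-chain (suc n)))

corollary5p5 : (n k : ℕ) → 2 ≤ n → 1 ≤ k → k < n →
    (pre : List ℕ) → length pre ≡ k ∸ 1 → (ak ak' : ℕ) →
    (NextIn (G n) (pre ++ [ ak ] ++ replicate (n ∸ k) 1)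
                  (pre ++ [ ak' ] ++ replicate (n ∸ k) 1)
      → (ak' ≡ suc ak → 2 ∣ ak) × (suc ak' ≡ ak → ¬ (2 ∣ ak)))
    × (NextIn (G n) (pre ++ [ ak ] ++ oddTail k n)
                    (pre ++ [ ak' ] ++ oddTail k n)
      → (ak' ≡ suc ak → ¬ (2 ∣ ak)) × (suc ak' ≡ ak → 2 ∣ ak))
corollary5p5 n k _ _ k<n pre _ ak ak' =
  (λ next → let (_ , (_ , onesSteps , _)) = invariant next
            in even-step (onesSteps k pre ak ak' k<n refl refl)) ,
  (λ next → let (_ , (_ , _ , oddSteps)) = invariant next
            in odd-step (oddSteps k pre ak ak' k<n refl refl))
  where
  invariant : ∀ {u v} → NextIn (G n) u v → ∃ λ p → StepInv n p u v
  invariant (before , after , G≡) =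
    chain-adjacent before (subst (Chain (StepInv n) 1ℙ) G≡ (G-chain n))
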